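{- Let $T$ be a tree on $n$ vertices with diameter $d\geq 4$, and let $L(T)$ be its line graph. If $d$ is even, then \[ \left\lceil\frac{n-d-1}{d-1}\right\rceil \leq \nabla(L(T))\leq n-d-1. \] If $d$ is odd, then \[ \left\lceil\frac{n-d-2}{d-2}\right\rceil \leq \nabla(L(T))\leq n-d-1. \]
   Context: The line graph $L(G)$ of a graph $G$ has the edges of $G$ as vertices, two being adjacent iff the corresponding edges share an endpoint. For a graph $H$, a decycling set is a set $F\subseteq V(H)$ such that $H-F$ is acyclic; the decycling number $\nabla(H)$ is the minimum cardinality of a decycling set of $H$. -}

module Defs where

open import Data.Nat using (ℕ; zero; suc; _+_; _≤_; _<_)
open import Data.Nat.DivMod using (_/_)
open import Data.Fin as Fin using (Fin)
open import Data.Bool using (Bool; T)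
open import Data.List using (List; []; _∷_; length; _∷ʳ_)
open import Data.List.Relation.Unary.All using (All)
open import Data.List.Relation.Unary.Unique.Propositional using (Unique)
open import Data.List.Relation.Unary.Linked using (Linked)
open import Data.List.Membership.Propositional using (_∉_)
open import Data.Product using (Σ; ∃; ∃-syntax; _×_; proj₁; proj₂; _,_)
open import Data.Sum using (_⊎_)
open import Relation.Binary.PropositionalEquality using (_≡_; _≢_)
open import Relation.Nullary using (¬_)

record Graph : Set₁ where
  field
    Vtx : Set
    Adj : Vtx → Vtx → Set

open Graph public

module _ (G : Graph) where

  record Cycle : Set where
    field
      first  : Vtx G
      rest   : List (Vtx G)
      long   : 3 ≤ length (first ∷ rest)
      unique : Unique (first ∷ rest)
      closed : Linked (Adj G) ((first ∷ rest) ∷ʳ first)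

  cycleVertices : Cycle → List (Vtx G)
  cycleVertices c = Cycle.first c ∷ Cycle.rest c

  AcyclicWithout : List (Vtx G) → Set
  AcyclicWithout F = ¬ (Σ Cycle λ c → All (λ v → v ∉ F) (cycleVertices c))

  IsDecyclingSet : List (Vtx G) → Set
  IsDecyclingSet F = Unique F × AcyclicWithout F

  IsDecyclingNumber : ℕ → Set
  IsDecyclingNumber k =
    (∃[ F ] (IsDecyclingSet F × length F ≡ k)) ×
    (∀ F → IsDecyclingSet F → k ≤ length F)

  Acyclic : Set
  Acyclic = AcyclicWithout []

  data Walk : Vtx G → Vtx G → ℕ → Set where
    [] : ∀ {u} → Walk u u 0
    _∷_ : ∀ {u v w k} → Adj G u v → Walk v w k → Walk u w (suc k)

  Connected : Set
  Connected = ∀ u v → ∃[ k ] Walk u v k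

  IsDistance : Vtx G → Vtx G → ℕ → Set
  IsDistance u v k = Walk u v k × (∀ m → Walk u v m → k ≤ m)

  IsDiameter : ℕ → Set
  IsDiameter d =
    (∃[ u ] ∃[ v ] IsDistance u v d) ×
    (∀ u v k → IsDistance u v k → k ≤ d)

record SimpleGraph (n : ℕ) : Set where
  field
    adj    : Fin n → Fin n → Bool
    sym    : ∀ u v → adj u v ≡ adj v u
    irrefl : ∀ u → ¬ T (adj u u)

open SimpleGraph public

toGraph : ∀ {n} → SimpleGraph n → Graph
toGraph {n} G = record { Vtx = Fin n ; Adj = λ u v → T (adj G u v) }

IsTree : ∀ {n} → SimpleGraph n → Set
IsTree G = Connected (toGraph G) × Acyclic (toGraph G)

-- An edge of G: an unordered pair {u,v}, represented as (u , v) with u < v.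
Edge : ∀ {n} → SimpleGraph n → Set
Edge {n} G = Σ (Fin n × Fin n) λ p → proj₁ p Fin.< proj₂ p × T (adj G (proj₁ p) (proj₂ p))

EdgesAdjacent : ∀ {n} (G : SimpleGraph n) → Edge G → Edge G → Set
EdgesAdjacent G ((a , b) , _) ((c , d) , _) =
  ((a , b) ≢ (c , d)) × (a ≡ c ⊎ a ≡ d ⊎ b ≡ c ⊎ b ≡ d)

LineGraph : ∀ {n} → SimpleGraph n → Graph
LineGraph G = record { Vtx = Edge G ; Adj = EdgesAdjacent G }

-- ceiling division ⌈ a / b ⌉ (b > 0; value 0 for b = 0, never used)
⌈_/_⌉ : ℕ → ℕ → ℕ
⌈ a / zero ⌉ = 0
⌈ a / suc b ⌉ = (a + b) / suc b

-- Let P = u … v be a diametral path.  Rooting T at u, delete from L(T) the parent edges of all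
-- vertices off P: what remains is the line graph of P, a path, so ∇(L(T)) ≤ n − d − 1.
--
-- Conversely let F be decycling and root T at a centre c of P, so that all depths are at most ⌈d/2⌉.
-- No vertex of T keeps three edges in L(T) − F, since they would form a triangle.  Hence every
-- component of T − F consists of its top, which is c or the lower end of an edge of F, and at most
-- two arms descending from it, so it has at most 2h + 1 vertices where h is the height it spans.
-- For even d this gives n ≤ (d + 1) + |F|(d − 1).  For odd d a component hanging at depth 1 may
-- reach the deepest level only below the neighbour a of c towards v; if a tops its own component,
-- that component's two extra vertices are paid for by the central one, which then misses the
-- deepest level, and n ≤ (d + 2) + |F|(d − 2).

module Submission where

open import Defs
open import Data.Nat using (ℕ; zero; suc; _+_; _*_; _∸_; _≤_; _<_; z≤n; s≤s)
import Data.Nat.Properties as ℕ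
open import Data.Nat.DivMod using (_%_; _/_; m≡m%n+[m/n]*n; m<n*o⇒m/o<n; m≥n⇒m/n>0)
open import Data.Nat.Tactic.RingSolver using (solve-∀)
open import Data.Bool using (Bool; true; false; T; if_then_else_)
open import Data.Bool.Properties using (T?; T-irrelevant)
open import Data.Fin as Fin using (Fin; toℕ)
import Data.Fin.Properties as Fin
open import Data.Maybe using (Maybe; just; nothing)
import Data.Maybe.Relation.Unary.Any as Maybe
open import Data.List using (List; []; _∷_; length; _∷ʳ_; map; mapMaybe; filter; allFin; lookup)
import Data.List.Properties as List
open import Data.List.Relation.Unary.All as All using (All; []; _∷_)
import Data.List.Relation.Unary.All.Properties as All
open import Data.List.Relation.Unary.Any as Any using (Any)
import Data.List.Relation.Unary.Any.Properties as Any
open import Data.List.Relation.Unary.AllPairs using (AllPairs; []; _∷_)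
import Data.List.Relation.Unary.AllPairs.Properties as AllPairs
open import Data.List.Relation.Unary.Unique.Propositional using (Unique)
import Data.List.Relation.Unary.Unique.Propositional.Properties as Unique
open import Data.List.Relation.Unary.Linked using (Linked; []; [-]; _∷_)
open import Data.List.Membership.Propositional using (_∈_; _∉_)
import Data.List.Membership.Propositional.Properties as ∈
open import Data.Product using (Σ; ∃; ∃-syntax; _×_; proj₁; proj₂; _,_; uncurry)
import Data.Product.Properties as Product
open import Data.Sum as Sum using (_⊎_; inj₁; inj₂; swap)
import Data.Sum.Properties as Sum
open import Data.Empty using (⊥; ⊥-elim)
open import Function using (_∘_; _∋_)
open import Relation.Binary using (tri<; tri≈; tri>)
open import Relation.Binary.PropositionalEquality as ≡ using (_≡_; _≢_; refl; cong; cong₂; subst; ≢-sym)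
open import Relation.Nullary using (¬_; Dec; yes; no; does; contradiction)
open import Relation.Nullary.Decidable using (_×-dec_; _⊎-dec_; ¬?; decidable-stable; dec-true; dec-false)
open import Relation.Unary using (Decidable)

minimal : {P : ℕ → Set} → Decidable P → ∀ k → P k → ∃[ m ] P m × (∀ j → P j → m ≤ j)
minimal P? zero p = zero , p , λ _ _ → z≤n
minimal P? (suc k) p with P? zero
... | yes p₀ = zero , p₀ , λ _ _ → z≤n
... | no ¬p₀ with minimal (P? ∘ suc) k p
...   | m , pm , least = suc m , pm , λ where
          zero p₀ → contradiction p₀ ¬p₀
          (suc j) pj → s≤s (least j pj)

private
  variable
    A B : Set

module _ (f : A → Maybe B) where

  length-mapMaybe+filter : ∀ {P : A → Set} (P? : Decidable P) → (∀ {x} → P x → f x ≡ nothing) →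
                           ∀ xs → length (mapMaybe f xs) + length (filter P? xs) ≤ length xs
  length-mapMaybe+filter P? P⇒nothing [] = z≤n
  length-mapMaybe+filter P? P⇒nothing (x ∷ xs) with P? x | f x in fx
  ... | yes px | just _  = contradiction (≡.trans (≡.sym fx) (P⇒nothing px)) λ ()
  ... | yes px | nothing = ℕ.≤-trans (ℕ.≤-reflexive (ℕ.+-suc _ _)) (s≤s (length-mapMaybe+filter P? P⇒nothing xs))
  ... | no ¬px | just _  = s≤s (length-mapMaybe+filter P? P⇒nothing xs)
  ... | no ¬px | nothing = ℕ.m≤n⇒m≤1+n (length-mapMaybe+filter P? P⇒nothing xs)

  mapMaybe-unique : (∀ {x y b} → f x ≡ just b → f y ≡ just b → x ≡ y) →
                    ∀ {xs} → Unique xs → Unique (mapMaybe f xs)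
  mapMaybe-unique inj {[]}     []         = []
  mapMaybe-unique inj {x ∷ xs} (x∉xs ∷ u) with f x in fx
  ... | nothing = mapMaybe-unique inj u
  ... | just b  = fresh x∉xs ∷ mapMaybe-unique inj u
    where
    fresh : ∀ {ys} → All (x ≢_) ys → All (b ≢_) (mapMaybe f ys)
    fresh []                      = []
    fresh {y ∷ ys} (x≢y ∷ x∉ys) with f y in fy
    ... | nothing = fresh x∉ys
    ... | just c  = (λ b≡c → x≢y (inj fx (≡.trans fy (cong just (≡.sym b≡c))))) ∷ fresh x∉ys

  ∈-mapMaybe⁺ : ∀ {x xs b} → x ∈ xs → f x ≡ just b → b ∈ mapMaybe f xs
  ∈-mapMaybe⁺ {xs = xs} x∈xs fx = Any.mapMaybe⁺ f xs
    (Any.map⁺ (Any.map (λ { refl → subst (Maybe.Any (_ ≡_)) (≡.sym fx) (Maybe.just refl) }) x∈xs))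

module _ {P : A → Set} (f : A → B) where

  linked-map-on : ∀ {R : A → A → Set} {S : B → B → Set} → (∀ {x y} → P x → P y → R x y → S (f x) (f y)) →
                  ∀ {xs} → All P xs → Linked R xs → Linked S (map f xs)
  linked-map-on R⇒S _                []          = []
  linked-map-on R⇒S _                [-]         = [-]
  linked-map-on R⇒S (px ∷ py ∷ pxs) (r ∷ rxs) = R⇒S px py r ∷ linked-map-on R⇒S (py ∷ pxs) rxs

  unique-map-on : (∀ {x y} → P x → P y → f x ≡ f y → x ≡ y) →
                  ∀ {xs} → All P xs → Unique xs → Unique (map f xs)
  unique-map-on inj []         []         = []
  unique-map-on inj (px ∷ pxs) (x∉xs ∷ u) = fresh pxs x∉xs ∷ unique-map-on inj pxs u
    where
    fresh : ∀ {ys} → All P ys → All (_ ≢_) ys → All (f _ ≢_) (map f ys)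
    fresh []         []           = []
    fresh (py ∷ pys) (x≢y ∷ x∉ys) = (λ fx≡fy → x≢y (inj px py fx≡fy)) ∷ fresh pys x∉ys

acyclic-reflected : ∀ {G H : Graph} (F : List (Vtx G)) (f : Vtx G → Vtx H) →
  (∀ {x y} → x ∉ F → y ∉ F → f x ≡ f y → x ≡ y) →
  (∀ {x y} → x ∉ F → y ∉ F → Adj G x y → Adj H (f x) (f y)) →
  Acyclic H → AcyclicWithout G F
acyclic-reflected {G} {H} F f inj adj acyclicH (c , avoids) = acyclicH (image , All.tabulate λ _ ())
  where
  open Cycle c
  image : Cycle H
  image = record
    { first  = f first
    ; rest   = map f rest
    ; long   = subst (3 ≤_) (≡.sym (List.length-map f (first ∷ rest))) long
    ; unique = unique-map-on f inj avoids unique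
    ; closed = subst (Linked (Adj H)) (List.map-++ f (first ∷ rest) (first ∷ []))
                 (linked-map-on f adj (All.++⁺ avoids (All.head avoids ∷ [])) closed)
    }

ℕ-path : Graph
ℕ-path = record { Vtx = ℕ ; Adj = λ i j → suc i ≡ j ⊎ suc j ≡ i }

private
  _∼_ : ℕ → ℕ → Set
  _∼_ = Adj ℕ-path

  -- After a step up, a ±1 walk through fresh values can only keep going up; dually for down.
  ascending : ∀ {a b z} l → suc a ≡ b → All (a ≢_) (b ∷ l) → AllPairs _≢_ (b ∷ l) →
              Linked _∼_ (b ∷ l ∷ʳ z) → (a + suc (length l)) ∼ z
  ascending {a} {z = z} [] refl _ _ (r ∷ [-]) = subst (_∼ z) (ℕ.+-comm 1 a) r
  ascending (c ∷ l) refl (_ ∷ a≢c ∷ _) _ (inj₂ c+1≡b ∷ _) = ⊥-elim (a≢c (ℕ.suc-injective (≡.sym c+1≡b)))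
  ascending {a} {z = z} (c ∷ l) refl _ (b∉l ∷ u) (inj₁ b+1≡c ∷ lk) =
    subst (_∼ z) (≡.sym (ℕ.+-suc a (suc (length l)))) (ascending l b+1≡c b∉l u lk)

  descending : ∀ {a b z} l → suc b ≡ a → All (a ≢_) (b ∷ l) → AllPairs _≢_ (b ∷ l) →
               Linked _∼_ (b ∷ l ∷ʳ z) → ∃[ m ] m + suc (length l) ≡ a × m ∼ z
  descending {b = b} [] refl _ _ (r ∷ [-]) = b , ℕ.+-comm b 1 , r
  descending (c ∷ l) refl (_ ∷ a≢c ∷ _) _ (inj₁ b+1≡c ∷ _) = ⊥-elim (a≢c b+1≡c)
  descending (c ∷ l) refl _ (b∉l ∷ u) (inj₂ c+1≡b ∷ lk) with descending l c+1≡b b∉l u lk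
  ... | m , m+l≡b , m∼z = m , ≡.trans (ℕ.+-suc m (suc (length l))) (cong suc m+l≡b) , m∼z

ℕ-path-acyclic : Acyclic ℕ-path
ℕ-path-acyclic (record { rest = [] ; long = s≤s () } , _)
ℕ-path-acyclic (record { rest = _ ∷ [] ; long = s≤s (s≤s ()) } , _)
ℕ-path-acyclic (record { first = x ; rest = _ ∷ y′ ∷ l ; unique = x∉ ∷ u ; closed = inj₁ up ∷ lk } , _)
  with ascending (y′ ∷ l) up x∉ u lk
... | inj₁ over  = ℕ.m≢1+m+n x (≡.sym over)
... | inj₂ under = ℕ.m≢1+m+n x (≡.trans (ℕ.suc-injective (≡.trans under (ℕ.+-suc x _))) (ℕ.+-suc x (length l)))
ℕ-path-acyclic (record { first = x ; rest = _ ∷ y′ ∷ l ; unique = x∉ ∷ u ; closed = inj₂ down ∷ lk } , _)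
  with descending (y′ ∷ l) down x∉ u lk
... | m , m+l≡x , inj₁ over  =
  ℕ.m+1+n≢m m (ℕ.suc-injective (≡.trans (≡.sym (ℕ.+-suc m _)) (≡.trans m+l≡x (≡.sym over))))
... | m , m+l≡x , inj₂ under = ℕ.<-irrefl refl (subst (_≤ x) (≡.sym under) (subst (m ≤_) m+l≡x (ℕ.m≤m+n m _)))

injective⇒≤+* : ∀ {n a k m} (f : Fin n → Fin a ⊎ (Fin k × Fin m)) →
                (∀ {x y} → f x ≡ f y → x ≡ y) → n ≤ a + k * m
injective⇒≤+* {a = a} {k} {m} f f-injective = Fin.injective⇒≤ {f = flatten ∘ f} (f-injective ∘ flatten-injective)
  where
  pair : Fin a ⊎ (Fin k × Fin m) → Fin a ⊎ Fin (k * m)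
  pair = Sum.map₂ (uncurry Fin.combine)
  flatten : Fin a ⊎ (Fin k × Fin m) → Fin (a + k * m)
  flatten = Fin.join a (k * m) ∘ pair
  pair-injective : ∀ {x y} → pair x ≡ pair y → x ≡ y
  pair-injective {inj₁ _}       {inj₁ _}       refl = refl
  pair-injective {inj₂ (i , j)} {inj₂ (i′ , j′)} eq with Fin.combine-injective i j i′ j′ (Sum.inj₂-injective eq)
  ... | refl , refl = refl
  flatten-injective : ∀ {x y} → flatten x ≡ flatten y → x ≡ y
  flatten-injective {x} {y} eq = pair-injective (begin
    pair x                               ≡⟨ Fin.splitAt-join a (k * m) (pair x) ⟨
    Fin.splitAt a (flatten x)            ≡⟨ cong (Fin.splitAt a) eq ⟩
    Fin.splitAt a (flatten y)            ≡⟨ Fin.splitAt-join a (k * m) (pair y) ⟩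
    pair y                               ∎)
    where open ≡.≡-Reasoning

module Walks {n : ℕ} (G : SimpleGraph n) where

  infix 4 _~_
  _~_ : Fin n → Fin n → Set
  u ~ v = T (adj G u v)

  ~-sym : ∀ {u v} → u ~ v → v ~ u
  ~-sym {u} {v} = subst T (sym G u v)

  ~-irrefl : ∀ {u v} → u ~ v → u ≢ v
  ~-irrefl {u} u~u refl = irrefl G u u~u

  Walkᴳ : Fin n → Fin n → ℕ → Set
  Walkᴳ = Walk (toGraph G)

  walk-snoc : ∀ {u v w k} → Walkᴳ u v k → v ~ w → Walkᴳ u w (suc k)
  walk-snoc []      v~w = v~w ∷ []
  walk-snoc (e ∷ p) v~w = e ∷ walk-snoc p v~w

  walk-reverse : ∀ {u v k} → Walkᴳ u v k → Walkᴳ v u k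
  walk-reverse []      = []
  walk-reverse (e ∷ p) = walk-snoc (walk-reverse p) (~-sym e)

  walk-++ : ∀ {u v w j k} → Walkᴳ u v j → Walkᴳ v w k → Walkᴳ u w (j + k)
  walk-++ []      q = q
  walk-++ (e ∷ p) q = e ∷ walk-++ p q

  walk-splitAt : ∀ j {k u w} → Walkᴳ u w (j + k) → ∃[ x ] Walkᴳ u x j × Walkᴳ x w k
  walk-splitAt zero    p       = _ , [] , p
  walk-splitAt (suc j) (e ∷ p) with walk-splitAt j p
  ... | x , p₁ , p₂ = x , e ∷ p₁ , p₂

  walk? : ∀ k u v → Dec (Walkᴳ u v k)
  walk? zero u v with u Fin.≟ v
  ... | yes refl = yes []
  ... | no u≢v   = no λ { [] → u≢v refl }
  walk? (suc k) u v with Fin.any? (λ w → T? (adj G u w) ×-dec walk? k w v)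
  ... | yes (w , e , p) = yes (e ∷ p)
  ... | no ∄w           = no λ { (e ∷ p) → ∄w (_ , e , p) }

  distance : Connected (toGraph G) → ∀ u v → ∃[ k ] IsDistance (toGraph G) u v k
  distance conn u v = minimal (λ k → walk? k u v) (proj₁ (conn u v)) (proj₂ (conn u v))

  data Chain : Fin n → List (Fin n) → Fin n → Set where
    [_] : ∀ {x y} → x ~ y → Chain x [] y
    _∷_ : ∀ {x z l y} → x ~ z → Chain z l y → Chain x (z ∷ l) y

  chain-snoc : ∀ {x l y z} → Chain x l y → y ~ z → Chain x (l ∷ʳ y) z
  chain-snoc [ e ]    f = e ∷ [ f ]
  chain-snoc (e ∷ c) f = e ∷ chain-snoc c f

  chain-linked : ∀ {x l y} → Chain x l y → Linked _~_ (x ∷ l ∷ʳ y)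
  chain-linked [ e ]   = e ∷ [-]
  chain-linked (e ∷ c) = e ∷ chain-linked c

  closed-chain⇒cycle : ∀ {x l} → Chain x l x → Unique (x ∷ l) → 3 ≤ length (x ∷ l) → Cycle (toGraph G)
  closed-chain⇒cycle {x} {l} c u len = record
    { first = x ; rest = l ; long = len ; unique = u ; closed = chain-linked c }

module Edges {n : ℕ} (G : SimpleGraph n) where
  open Walks G

  Joins : Edge G → Fin n → Fin n → Set
  Joins e a b = proj₁ e ≡ (a , b) ⊎ proj₁ e ≡ (b , a)

  joins? : ∀ e a b → Dec (Joins e a b)
  joins? e a b = pair? (proj₁ e) (a , b) ⊎-dec pair? (proj₁ e) (b , a)
    where pair? = Product.≡-dec Fin._≟_ Fin._≟_

  joins-sym : ∀ {e a b} → Joins e a b → Joins e b a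
  joins-sym = swap

  joins-unique : ∀ {e e′ a b} → Joins e a b → Joins e′ a b → e ≡ e′
  joins-unique {e} {e′} j j′ = same-ends (cases {e} {e′} j j′)
    where
    same-ends : ∀ {e e′ : Edge G} → proj₁ e ≡ proj₁ e′ → e ≡ e′
    same-ends {(p , a<b , a~b)} {(.p , a<b′ , a~b′)} refl
      rewrite ℕ.≤-irrelevant a<b a<b′ | T-irrelevant a~b a~b′ = refl
    cases : ∀ {e e′ : Edge G} {a b} → Joins e a b → Joins e′ a b → proj₁ e ≡ proj₁ e′
    cases (inj₁ p) (inj₁ q) = ≡.trans p (≡.sym q)
    cases (inj₂ p) (inj₂ q) = ≡.trans p (≡.sym q)
    cases {(_ , a<b , _)} {(_ , b<a , _)} (inj₁ refl) (inj₂ refl) = ⊥-elim (ℕ.<-asym a<b b<a)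
    cases {(_ , b<a , _)} {(_ , a<b , _)} (inj₂ refl) (inj₁ refl) = ⊥-elim (ℕ.<-asym a<b b<a)

  edge-at : ∀ {a b} → a ~ b → Σ (Edge G) λ e → Joins e a b
  edge-at {a} {b} a~b with Fin.<-cmp a b
  ... | tri< a<b _ _ = ((a , b) , a<b , a~b) , inj₁ refl
  ... | tri≈ _ a≡b _ = ⊥-elim (~-irrefl a~b a≡b)
  ... | tri> _ _ b<a = ((b , a) , b<a , ~-sym a~b) , inj₂ refl

  edges-adjacent-at : ∀ {v x y} (e e′ : Edge G) → Joins e v x → Joins e′ v y →
                      v ≢ x → v ≢ y → x ≢ y → EdgesAdjacent G e e′
  edges-adjacent-at _ _ (inj₁ refl) (inj₁ refl) _   _   x≢y = (λ p → x≢y (cong proj₂ p)) , inj₁ refl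
  edges-adjacent-at _ _ (inj₁ refl) (inj₂ refl) _   v≢y _   = (λ p → v≢y (cong proj₁ p)) , inj₂ (inj₁ refl)
  edges-adjacent-at _ _ (inj₂ refl) (inj₁ refl) v≢x _   _   = (λ p → v≢x (≡.sym (cong proj₁ p))) , inj₂ (inj₂ (inj₁ refl))
  edges-adjacent-at _ _ (inj₂ refl) (inj₂ refl) _   _   x≢y = (λ p → x≢y (cong proj₁ p)) , inj₂ (inj₂ (inj₂ refl))

  Endpoint : Edge G → Fin n → Set
  Endpoint e y = y ≡ proj₁ (proj₁ e) ⊎ y ≡ proj₂ (proj₁ e)

  joins-endpoint : ∀ {e a b y} → Joins e a b → Endpoint e y → y ≡ a ⊎ y ≡ b
  joins-endpoint {(_ , _) , _} (inj₁ refl) y∈e = y∈e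
  joins-endpoint {(_ , _) , _} (inj₂ refl) y∈e = swap y∈e

  shared-endpoint : ∀ {e e′} → EdgesAdjacent G e e′ → ∃[ y ] Endpoint e y × Endpoint e′ y
  shared-endpoint {(a , _) , _} (_ , inj₁ refl)                = a , inj₁ refl , inj₁ refl
  shared-endpoint {(a , _) , _} (_ , inj₂ (inj₁ refl))         = a , inj₁ refl , inj₂ refl
  shared-endpoint {(_ , b) , _} (_ , inj₂ (inj₂ (inj₁ refl)))  = b , inj₂ refl , inj₁ refl
  shared-endpoint {(_ , b) , _} (_ , inj₂ (inj₂ (inj₂ refl)))  = b , inj₂ refl , inj₂ refl

  module Removing (F : List (Edge G)) where

    Removed : Fin n → Fin n → Set
    Removed a b = Any (λ e → Joins e a b) F

    removed? : ∀ a b → Dec (Removed a b)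
    removed? a b = Any.any? (λ e → joins? e a b) F

    removed-sym : ∀ {a b} → Removed a b → Removed b a
    removed-sym = Any.map (λ {e} → joins-sym {e})

    Surviving : Fin n → Fin n → Set
    Surviving a b = a ~ b × ¬ Removed a b

    -- Three surviving edges at one vertex form a triangle of L(G) − F.
    no-surviving-claw : AcyclicWithout (LineGraph G) F → ∀ {v x y z} →
      Surviving v x → Surviving v y → Surviving v z → x ≢ y → x ≢ z → y ≢ z → ⊥
    no-surviving-claw acyclic {v} {x} {y} {z} (v~x , ¬rx) (v~y , ¬ry) (v~z , ¬rz) x≢y x≢z y≢z =
      acyclic (record { first = ex ; rest = ey ∷ ez ∷ [] ; long = s≤s (s≤s (s≤s z≤n))
                      ; unique = (ends≢ exy ∷ ends≢ exz ∷ []) ∷ (ends≢ eyz ∷ []) ∷ [] ∷ []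
                      ; closed = exy ∷ eyz ∷ ezx ∷ [-] }
              , kept jx ¬rx ∷ kept jy ¬ry ∷ kept jz ¬rz ∷ [])
      where
      ex = proj₁ (edge-at v~x) ; jx = proj₂ (edge-at v~x)
      ey = proj₁ (edge-at v~y) ; jy = proj₂ (edge-at v~y)
      ez = proj₁ (edge-at v~z) ; jz = proj₂ (edge-at v~z)
      exy = edges-adjacent-at ex ey jx jy (~-irrefl v~x) (~-irrefl v~y) x≢y
      exz = edges-adjacent-at ex ez jx jz (~-irrefl v~x) (~-irrefl v~z) x≢z
      eyz = edges-adjacent-at ey ez jy jz (~-irrefl v~y) (~-irrefl v~z) y≢z
      ezx = edges-adjacent-at ez ex jz jx (~-irrefl v~z) (~-irrefl v~x) (≢-sym x≢z)
      ends≢ : ∀ {e e′} → EdgesAdjacent G e e′ → e ≢ e′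
      ends≢ adj e≡e′ = proj₁ adj (cong proj₁ e≡e′)
      kept : ∀ {e a b} → Joins e a b → ¬ Removed a b → ¬ e ∈ F
      kept j ¬r e∈F = ¬r (Any.map (λ e≡e′ → subst (λ e → Joins e _ _) e≡e′ j) e∈F)

module RootedTree {n : ℕ} (G : SimpleGraph n) (tree : IsTree G) (root : Fin n) where
  open Walks G
  open Edges G

  private
    geodesic : ∀ v → ∃[ k ] IsDistance (toGraph G) v root k
    geodesic v = distance (proj₁ tree) v root

    next : ∀ {u w k} → Walkᴳ u w k → Fin n
    next {u} []                = u
    next (_∷_ {v = v} _ _) = v

    next-step : ∀ {v k m} (p : Walkᴳ v root k) → k ≡ suc m → v ~ next p × Walkᴳ (next p) root m
    next-step (e ∷ p) refl = e , p

    next-[] : ∀ {v k} (p : Walkᴳ v root k) → k ≡ 0 → v ≡ root × next p ≡ root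
    next-[] [] refl = refl , refl

  depth : Fin n → ℕ
  depth v = proj₁ (geodesic v)

  path-to-root : ∀ v → Walkᴳ v root (depth v)
  path-to-root v = proj₁ (proj₂ (geodesic v))

  depth-minimal : ∀ v j → Walkᴳ v root j → depth v ≤ j
  depth-minimal v = proj₂ (proj₂ (geodesic v))

  parent : Fin n → Fin n
  parent v = next (path-to-root v)

  depth-adjacent : ∀ {u w} → u ~ w → depth u ≤ suc (depth w)
  depth-adjacent {u} {w} e = depth-minimal u _ (e ∷ path-to-root w)

  depth-root : depth root ≡ 0
  depth-root = ℕ.n≤0⇒n≡0 (depth-minimal root 0 [])

  depth≡0⇒root : ∀ {v} → depth v ≡ 0 → v ≡ root
  depth≡0⇒root {v} e = proj₁ (next-[] (path-to-root v) e)

  non-root-deep : ∀ {v} → v ≢ root → 0 < depth v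
  non-root-deep {v} v≢root = ℕ.n≢0⇒n>0 (v≢root ∘ depth≡0⇒root)

  parent-spec : ∀ v {m} → depth v ≡ suc m → v ~ parent v × depth (parent v) ≡ m
  parent-spec v {m} e with next-step (path-to-root v) e
  ... | v~p , p = v~p , ℕ.≤-antisym (depth-minimal _ m p)
                          (ℕ.≤-pred (subst (_≤ suc (depth (parent v))) e (depth-adjacent v~p)))

  depth-parent : ∀ v → depth (parent v) ≡ depth v ∸ 1
  depth-parent v = from (depth v) refl
    where
    from : ∀ k → depth v ≡ k → depth (parent v) ≡ k ∸ 1
    from zero    e = ≡.trans (cong depth (proj₂ (next-[] (path-to-root v) e))) depth-root
    from (suc m) e = proj₂ (parent-spec v e)

  no-closed-chain : ∀ {x l} → Chain x l x → Unique (x ∷ l) → 3 ≤ length (x ∷ l) → ⊥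
  no-closed-chain c u len = proj₂ tree (closed-chain⇒cycle c u len , All.tabulate λ _ ())

  private
    shallower⇒≢ : ∀ {x j zs} → depth x ≡ j → All (λ z → depth z < j) zs → All (x ≢_) zs
    shallower⇒≢ dx = All.map λ lt x≡z → ℕ.<⇒≢ lt (≡.trans (cong depth (≡.sym x≡z)) dx)

    <-suc : ∀ {z m} → depth z ≡ m → depth z < suc m
    <-suc {m = m} e = subst (_< suc m) (≡.sym e) (ℕ.n<1+n m)

    unique-bracket : ∀ {j x y M} → Unique M → All (λ z → depth z < j) M →
                     depth x ≡ j → depth y ≡ j → x ≢ y → Unique (x ∷ M ∷ʳ y)
    unique-bracket {M = M} u sh dx dy x≢y =
      All.∷ʳ⁺ (shallower⇒≢ dx sh) x≢y ∷
      AllPairs.++⁺ u ([] ∷ []) (All.map (λ z≢y → z≢y ∷ []) (All.map ≢-sym (shallower⇒≢ dy sh)))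

  chain-above : ∀ m {p q} → depth p ≡ m → depth q ≡ m → p ≢ q →
                ∃[ M ] Chain p M q × Unique M × All (λ x → depth x < m) M × 1 ≤ length M
  chain-above zero dp dq p≢q = ⊥-elim (p≢q (≡.trans (depth≡0⇒root dp) (≡.sym (depth≡0⇒root dq))))
  chain-above (suc m) {p} {q} dp dq p≢q with parent-spec p dp | parent-spec q dq | parent p Fin.≟ parent q
  ... | p~p′ , dp′ | q~q′ , _ | yes p′≡q′ =
    parent p ∷ [] , p~p′ ∷ [ ~-sym (subst (q ~_) (≡.sym p′≡q′) q~q′) ] , [] ∷ [] , <-suc dp′ ∷ [] , s≤s z≤n
  ... | p~p′ , dp′ | q~q′ , dq′ | no p′≢q′ with chain-above m dp′ dq′ p′≢q′
  ...   | M , c , u , sh , _ =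
    parent p ∷ (M ∷ʳ parent q) , p~p′ ∷ chain-snoc c (~-sym q~q′) , unique-bracket u sh dp′ dq′ p′≢q′ ,
    All.∷ʳ⁺ (<-suc dp′ ∷ All.map ℕ.m<n⇒m<1+n sh) (<-suc dq′) , s≤s z≤n

  upper-neighbour-unique : ∀ {m v p q} → depth v ≡ suc m → depth p ≡ m → depth q ≡ m →
                           v ~ p → v ~ q → p ≡ q
  upper-neighbour-unique {m} {v} {p} {q} dv dp dq v~p v~q with p Fin.≟ q
  ... | yes p≡q = p≡q
  ... | no p≢q with chain-above m dp dq p≢q
  ...   | M , c , u , sh , _ = ⊥-elim (no-closed-chain (v~p ∷ chain-snoc c (~-sym v~q))
            (shallower⇒≢ dv (All.∷ʳ⁺ (<-suc dp ∷ All.map ℕ.m<n⇒m<1+n sh) (<-suc dq)) ∷ unique-bracket u sh dp dq p≢q)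
            (s≤s (s≤s (subst (1 ≤_) (≡.sym (List.length-++ M)) (ℕ.m≤n+m 1 (length M))))))

  no-edge-within-level : ∀ {m u w} → depth u ≡ m → depth w ≡ m → u ~ w → ⊥
  no-edge-within-level {m} {u} {w} du dw u~w with chain-above m du dw (~-irrefl u~w)
  ... | M , c , uq , sh , 1≤|M| = no-closed-chain (chain-snoc c (~-sym u~w))
          (unique-bracket uq sh du dw (~-irrefl u~w))
          (s≤s (subst (2 ≤_) (≡.sym (List.length-++ M)) (ℕ.+-monoˡ-≤ 1 1≤|M|)))

  private
    deeper-neighbour : ∀ {x y} → x ~ y → depth y < depth x → depth x ≡ suc (depth y) × y ≡ parent x
    deeper-neighbour {x} {y} x~y lt = dx , ≡.sym (upper-neighbour-unique dx dp refl x~p x~y)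
      where
      dx = ℕ.≤-antisym (depth-adjacent x~y) lt
      x~p = proj₁ (parent-spec x dx)
      dp = proj₂ (parent-spec x dx)

  edge-is-parent-edge : ∀ {u w} → u ~ w →
    (depth u ≡ suc (depth w) × w ≡ parent u) ⊎ (depth w ≡ suc (depth u) × u ≡ parent w)
  edge-is-parent-edge {u} {w} u~w with ℕ.<-cmp (depth u) (depth w)
  ... | tri≈ _ e _  = ⊥-elim (no-edge-within-level e refl u~w)
  ... | tri< lt _ _ = inj₂ (deeper-neighbour (~-sym u~w) lt)
  ... | tri> _ _ gt = inj₁ (deeper-neighbour u~w gt)

  depth-child : ∀ {x} → 0 < depth x → depth x ≡ suc (depth (parent x))
  depth-child {x} pos = ≡.trans (≡.sym (ℕ.m∸n+n≡m pos))
    (≡.trans (ℕ.+-comm (depth x ∸ 1) 1) (cong suc (≡.sym (depth-parent x))))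

  parent-adjacent : ∀ {x} → 0 < depth x → x ~ parent x
  parent-adjacent pos = proj₁ (parent-spec _ (depth-child pos))

  ancestor : ℕ → Fin n → Fin n
  ancestor zero    v = v
  ancestor (suc j) v = ancestor j (parent v)

  depth-ancestor : ∀ j v → depth (ancestor j v) ≡ depth v ∸ j
  depth-ancestor zero    v = refl
  depth-ancestor (suc j) v = ≡.trans (depth-ancestor j (parent v))
    (≡.trans (cong (_∸ j) (depth-parent v)) (ℕ.∸-+-assoc (depth v) 1 j))

  parent-ancestor : ∀ i v → parent (ancestor i v) ≡ ancestor (suc i) v
  parent-ancestor zero    v = refl
  parent-ancestor (suc i) v = parent-ancestor i (parent v)

  ascent : ∀ j v → j ≤ depth v → Walkᴳ v (ancestor j v) j
  ascent zero    v _   = []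
  ascent (suc j) v j<d = parent-adjacent (ℕ.<-≤-trans (s≤s z≤n) j<d)
    ∷ ascent j (parent v) (subst (j ≤_) (≡.sym (depth-parent v)) (ℕ.∸-monoˡ-≤ 1 j<d))

  branch : Fin n → Fin n
  branch v = ancestor (depth v ∸ 1) v

  branch-parent : ∀ {x} → 1 < depth x → branch (parent x) ≡ branch x
  branch-parent {x} = from (depth x) refl
    where
    from : ∀ k → depth x ≡ k → 1 < k → branch (parent x) ≡ branch x
    from (suc zero)    _ (s≤s ())
    from (suc (suc m)) e _ = ≡.trans
      (cong (λ j → ancestor (j ∸ 1) (parent x)) (≡.trans (depth-parent x) (cong (_∸ 1) e)))
      (≡.sym (cong (λ j → ancestor (j ∸ 1) x) e))

  branch-adjacent : ∀ {x y} → x ~ y → 0 < depth x → 0 < depth y → branch x ≡ branch y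
  branch-adjacent x~y px py with edge-is-parent-edge x~y
  ... | inj₁ (dx , refl) = ≡.sym (branch-parent (subst (1 <_) (≡.sym dx) (s≤s py)))
  ... | inj₂ (dy , refl) = branch-parent (subst (1 <_) (≡.sym dy) (s≤s px))

  depth-along-walk : ∀ {x y L} → Walkᴳ x y L → depth y ≤ L + depth x
  depth-along-walk {x} {y} p = depth-minimal y _ (walk-++ (walk-reverse p) (path-to-root x))

  -- A walk between two branches passes through the root.
  walk-across-branches : ∀ {x y L} → Walkᴳ x y L → branch x ≢ branch y → depth x + depth y ≤ L
  walk-across-branches [] b≢b = ⊥-elim (b≢b refl)
  walk-across-branches {x} {y} (_∷_ {v = x′} {k = L} x~x′ p) b≢b
    with 0 ℕ.<? depth x | 0 ℕ.<? depth x′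
  ... | no ¬px | _ = begin
    depth x + depth y ≡⟨ cong (_+ depth y) dx≡0 ⟩
    depth y           ≤⟨ depth-along-walk (x~x′ ∷ p) ⟩
    suc L + depth x   ≡⟨ cong (suc L +_) dx≡0 ⟩
    suc L + 0         ≡⟨ ℕ.+-identityʳ (suc L) ⟩
    suc L             ∎
    where open ℕ.≤-Reasoning
          dx≡0 = ℕ.n≤0⇒n≡0 (ℕ.≮⇒≥ ¬px)
  ... | yes _ | no ¬px′ = begin
    depth x + depth y               ≤⟨ ℕ.+-mono-≤ (depth-adjacent x~x′) (depth-along-walk p) ⟩
    suc (depth x′) + (L + depth x′) ≡⟨ cong (λ k → suc k + (L + k)) dx′≡0 ⟩
    suc (L + 0)                     ≡⟨ cong suc (ℕ.+-identityʳ L) ⟩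
    suc L                           ∎
    where open ℕ.≤-Reasoning
          dx′≡0 = ℕ.n≤0⇒n≡0 (ℕ.≮⇒≥ ¬px′)
  ... | yes px | yes px′ = ℕ.≤-trans (ℕ.+-monoˡ-≤ (depth y) (depth-adjacent x~x′))
                             (s≤s (walk-across-branches p (b≢b ∘ ≡.trans (branch-adjacent x~x′ px px′))))


  parent-shallower : ∀ {t} → 0 < depth t → depth (parent t) < depth t
  parent-shallower pt = ℕ.≤-reflexive (≡.sym (depth-child pt))

  private
    no-2-cycle : ∀ {t t′} → 0 < depth t → 0 < depth t′ → t ≡ parent t′ → parent t ≡ t′ → ⊥
    no-2-cycle {t} {t′} pt pt′ t≡pt′ pt≡t′ = ℕ.<-asym
      (subst (λ s → depth s < depth t′) (≡.sym t≡pt′) (parent-shallower pt′))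
      (subst (λ s → depth s < depth t) pt≡t′ (parent-shallower pt))

  parent-edge-injective : ∀ {e t t′} → 0 < depth t → 0 < depth t′ →
                          Joins e t (parent t) → Joins e t′ (parent t′) → t ≡ t′
  parent-edge-injective _  _   (inj₁ p) (inj₁ q) = cong proj₁ (≡.trans (≡.sym p) q)
  parent-edge-injective _  _   (inj₂ p) (inj₂ q) = cong proj₂ (≡.trans (≡.sym p) q)
  parent-edge-injective pt pt′ (inj₁ p) (inj₂ q) = ⊥-elim (no-2-cycle pt pt′ (cong proj₁ same) (cong proj₂ same))
    where same = ≡.trans (≡.sym p) q
  parent-edge-injective pt pt′ (inj₂ p) (inj₁ q) = ⊥-elim (no-2-cycle pt pt′ (cong proj₂ same) (cong proj₁ same))
    where same = ≡.trans (≡.sym p) q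

  child : Edge G → Fin n
  child ((a , b) , _ , a~b) with edge-is-parent-edge a~b
  ... | inj₁ _ = a
  ... | inj₂ _ = b

  child-spec : ∀ e → 0 < depth (child e) × Joins e (child e) (parent (child e))
  child-spec ((a , b) , _ , a~b) with edge-is-parent-edge a~b
  ... | inj₁ (da , refl) = subst (0 <_) (≡.sym da) (s≤s z≤n) , inj₁ refl
  ... | inj₂ (db , refl) = subst (0 <_) (≡.sym db) (s≤s z≤n) , inj₂ refl

  endpoint-depth : ∀ {e y} → Endpoint e y → depth y ≡ depth (child e) ⊎ suc (depth y) ≡ depth (child e)
  endpoint-depth {e} y∈e with joins-endpoint {e} (proj₂ (child-spec e)) y∈e
  ... | inj₁ refl = inj₁ refl
  ... | inj₂ refl = inj₂ (≡.sym (depth-child (proj₁ (child-spec e))))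

module UpperBound {n : ℕ} (G : SimpleGraph n) (tree : IsTree G) {u v : Fin n} {d : ℕ}
                  (uv : IsDistance (toGraph G) u v d) where
  open Walks G
  open Edges G
  open RootedTree G tree u

  depth-v : depth v ≡ d
  depth-v = ℕ.≤-antisym (depth-minimal v d (walk-reverse (proj₁ uv))) (proj₂ uv _ (walk-reverse (path-to-root v)))

  OnPath : Fin n → Set
  OnPath w = ancestor (d ∸ depth w) v ≡ w

  onPath? : ∀ w → Dec (OnPath w)
  onPath? w = ancestor (d ∸ depth w) v Fin.≟ w

  depth-on-path : ∀ j → depth (ancestor j v) ≡ d ∸ j
  depth-on-path j = ≡.trans (depth-ancestor j v) (cong (_∸ j) depth-v)

  ancestor-on-path : ∀ {j} → j ≤ d → OnPath (ancestor j v)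
  ancestor-on-path {j} j≤d = cong (λ i → ancestor i v) (≡.trans (cong (d ∸_) (depth-on-path j)) (ℕ.m∸[m∸n]≡n j≤d))

  root-on-path : OnPath u
  root-on-path = ≡.trans (cong (λ k → ancestor (d ∸ k) v) depth-root)
                         (depth≡0⇒root (≡.trans (depth-on-path d) (ℕ.n∸n≡0 d)))

  off-path-deep : ∀ {w} → ¬ OnPath w → 0 < depth w
  off-path-deep ¬on = non-root-deep λ { refl → ¬on root-on-path }

  off-path-edge : Fin n → Maybe (Edge G)
  off-path-edge w with onPath? w
  ... | yes _  = nothing
  ... | no ¬on = just (proj₁ (edge-at (parent-adjacent (off-path-deep ¬on))))

  off-path-edge-on : ∀ {w} → OnPath w → off-path-edge w ≡ nothing
  off-path-edge-on {w} on with onPath? w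
  ... | yes _  = refl
  ... | no ¬on = contradiction on ¬on

  off-path-edge-off : ∀ {w} → ¬ OnPath w → ∃[ e ] off-path-edge w ≡ just e × Joins e w (parent w)
  off-path-edge-off {w} ¬on with onPath? w
  ... | yes on  = contradiction on ¬on
  ... | no ¬on′ = _ , refl , proj₂ (edge-at (parent-adjacent (off-path-deep ¬on′)))

  off-path-edge-joins : ∀ {w e} → off-path-edge w ≡ just e → 0 < depth w × Joins e w (parent w)
  off-path-edge-joins {w} eq with onPath? w
  off-path-edge-joins refl | no ¬on = off-path-deep ¬on , proj₂ (edge-at (parent-adjacent (off-path-deep ¬on)))

  F : List (Edge G)
  F = mapMaybe off-path-edge (allFin n)

  F-unique : Unique F
  F-unique = mapMaybe-unique off-path-edge inj (Unique.allFin⁺ n)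
    where
    inj : ∀ {x y e} → off-path-edge x ≡ just e → off-path-edge y ≡ just e → x ≡ y
    inj {e = e} fx fy with off-path-edge-joins fx | off-path-edge-joins fy
    ... | px , jx | py , jy = parent-edge-injective {e} px py jx jy

  path-vertices : List (Fin n)
  path-vertices = filter onPath? (allFin n)

  path-long : d + 1 ≤ length path-vertices
  path-long = subst (_≤ length path-vertices) (ℕ.+-comm 1 d) (Fin.injective⇒≤ {f = position} position-injective)
    where
    j≤d : (j : Fin (suc d)) → toℕ j ≤ d
    j≤d j = ℕ.≤-pred (Fin.toℕ<n j)
    member : (j : Fin (suc d)) → ancestor (toℕ j) v ∈ path-vertices
    member j = ∈.∈-filter⁺ onPath? (∈.∈-allFin _) (ancestor-on-path (j≤d j))
    position : Fin (suc d) → Fin (length path-vertices)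
    position j = Any.index (member j)
    depth-at : ∀ j → depth (lookup path-vertices (position j)) ≡ d ∸ toℕ j
    depth-at j = ≡.trans (cong depth (≡.sym (Any.lookup-index (member j)))) (depth-on-path (toℕ j))
    position-injective : ∀ {i j} → position i ≡ position j → i ≡ j
    position-injective {i} {j} eq = Fin.toℕ-injective (ℕ.∸-cancelˡ-≡ (j≤d i) (j≤d j)
      (≡.trans (≡.sym (depth-at i)) (≡.trans (cong (depth ∘ lookup path-vertices) eq) (depth-at j))))

  F-short : length F ≤ n ∸ d ∸ 1
  F-short = subst (length F ≤_) (≡.sym (ℕ.∸-+-assoc n d 1)) (ℕ.m+n≤o⇒m≤o∸n (length F) (begin
    length F + (d + 1)                   ≤⟨ ℕ.+-monoʳ-≤ (length F) path-long ⟩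
    length F + length path-vertices      ≤⟨ length-mapMaybe+filter off-path-edge onPath? off-path-edge-on (allFin n) ⟩
    length (allFin n)                    ≡⟨ List.length-tabulate (λ i → i) ⟩
    n                                    ∎))
    where open ℕ.≤-Reasoning

  surviving-on-path : ∀ {e} → e ∉ F → OnPath (child e)
  surviving-on-path {e} e∉F with onPath? (child e)
  ... | yes on  = on
  ... | no ¬on with off-path-edge-off ¬on
  ...   | e′ , fe′ , je′ = contradiction
    (subst (_∈ F) (joins-unique je′ (proj₂ (child-spec e))) (∈-mapMaybe⁺ off-path-edge (∈.∈-allFin _) fe′)) e∉F

  surviving-injective : ∀ {e e′} → e ∉ F → e′ ∉ F → depth (child e) ≡ depth (child e′) → e ≡ e′
  surviving-injective {e} {e′} e∉F e′∉F eq =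
    joins-unique (proj₂ (child-spec e)) (subst (λ c → Joins e′ c (parent c)) (≡.sym same-child) (proj₂ (child-spec e′)))
    where
    same-child : child e ≡ child e′
    same-child = ≡.trans (≡.sym (surviving-on-path e∉F))
                   (≡.trans (cong (λ k → ancestor (d ∸ k) v) eq) (surviving-on-path e′∉F))

  surviving-adjacent : ∀ {e e′} → e ∉ F → e′ ∉ F → EdgesAdjacent G e e′ →
                       Adj ℕ-path (depth (child e)) (depth (child e′))
  surviving-adjacent {e} {e′} e∉F e′∉F adj with shared-endpoint {e} {e′} adj
  ... | y , y∈e , y∈e′ with endpoint-depth {e} y∈e | endpoint-depth {e′} y∈e′
  ...   | inj₁ p | inj₁ q = ⊥-elim (proj₁ adj (cong proj₁ (surviving-injective e∉F e′∉F (≡.trans (≡.sym p) q))))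
  ...   | inj₂ p | inj₂ q = ⊥-elim (proj₁ adj (cong proj₁ (surviving-injective e∉F e′∉F (≡.trans (≡.sym p) q))))
  ...   | inj₁ p | inj₂ q = inj₁ (≡.trans (cong suc (≡.sym p)) q)
  ...   | inj₂ p | inj₁ q = inj₂ (≡.trans (cong suc (≡.sym q)) p)

  F-decycling : IsDecyclingSet (LineGraph G) F
  F-decycling = F-unique , acyclic-reflected F (depth ∘ child) surviving-injective surviving-adjacent ℕ-path-acyclic

  upper-bound : ∀ {k} → IsDecyclingNumber (LineGraph G) k → k ≤ n ∸ d ∸ 1
  upper-bound (_ , least) = ℕ.≤-trans (least F F-decycling) F-short

-- A component of T − F hangs from its top along at most two arms; numbering the vertex at height j
-- on arm s by arm-code j s (and the top by 0) interleaves the two arms.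
arm-code : ℕ → Bool → ℕ
arm-code zero    _ = 0
arm-code (suc j) s = suc (if s then suc (2 * j) else 2 * j)

arm-code≤ : ∀ j s → arm-code j s ≤ 2 * j
arm-code≤ zero    _     = z≤n
arm-code≤ (suc j) false = ℕ.≤-trans (ℕ.n≤1+n _) (ℕ.≤-reflexive (≡.sym (ℕ.*-suc 2 j)))
arm-code≤ (suc j) true  = ℕ.≤-reflexive (≡.sym (ℕ.*-suc 2 j))

arm-code-injective : ∀ {j j′ s s′} → arm-code (suc j) s ≡ arm-code (suc j′) s′ → j ≡ j′ × s ≡ s′
arm-code-injective {j} {j′} {false} {false} eq = ℕ.*-cancelˡ-≡ j j′ 2 (ℕ.suc-injective eq) , refl
arm-code-injective {j} {j′} {true}  {true}  eq = ℕ.*-cancelˡ-≡ j j′ 2 (ℕ.suc-injective (ℕ.suc-injective eq)) , refl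
arm-code-injective {j} {j′} {false} {true}  eq = ⊥-elim (ℕ.even≢odd j j′ (ℕ.suc-injective eq))
arm-code-injective {j} {j′} {true}  {false} eq = ⊥-elim (ℕ.even≢odd j′ j (ℕ.suc-injective (≡.sym eq)))

module Components {n : ℕ} (G : SimpleGraph n) (tree : IsTree G) (root : Fin n)
                  (F : List (Edge G)) (acyclic : AcyclicWithout (LineGraph G) F) where
  open Walks G
  open Edges G
  open Removing F
  open RootedTree G tree root

  Kept : Fin n → Set
  Kept x = 0 < depth x × ¬ Removed x (parent x)

  kept? : ∀ x → Dec (Kept x)
  kept? x = (0 ℕ.<? depth x) ×-dec ¬? (removed? x (parent x))

  root-not-kept : ∀ {x} → depth x ≡ 0 → ¬ Kept x
  root-not-kept dx (pos , _) = ℕ.<⇒≢ pos (≡.sym dx)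

  private
    root-above-not-kept : ∀ v → ¬ Kept (ancestor (depth v) v)
    root-above-not-kept v = root-not-kept (≡.trans (depth-ancestor (depth v) v) (ℕ.n∸n≡0 (depth v)))

    climbing : ∀ v → ∃[ m ] ¬ Kept (ancestor m v) × (∀ j → ¬ Kept (ancestor j v) → m ≤ j)
    climbing v = minimal (λ j → ¬? (kept? (ancestor j v))) (depth v) (root-above-not-kept v)

  -- Vertices with the same top form one component of T − F.
  climb : Fin n → ℕ
  climb v = proj₁ (climbing v)

  top : Fin n → Fin n
  top v = ancestor (climb v) v

  top-not-kept : ∀ v → ¬ Kept (top v)
  top-not-kept v = proj₁ (proj₂ (climbing v))

  kept-below-top : ∀ v {i} → i < climb v → Kept (ancestor i v)
  kept-below-top v {i} i<c = decidable-stable (kept? _) λ ¬k → ℕ.<⇒≱ i<c (proj₂ (proj₂ (climbing v)) i ¬k)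

  climb-unique : ∀ v j → (∀ {i} → i < j → Kept (ancestor i v)) → ¬ Kept (ancestor j v) → climb v ≡ j
  climb-unique v j below ¬k with ℕ.<-cmp (climb v) j
  ... | tri< c<j _ _ = contradiction (below c<j) (top-not-kept v)
  ... | tri≈ _ c≡j _ = c≡j
  ... | tri> _ _ j<c = contradiction (kept-below-top v j<c) ¬k

  climb-kept : ∀ {v} → Kept v → climb v ≡ suc (climb (parent v))
  climb-kept {v} k = climb-unique v _ below (top-not-kept (parent v))
    where
    below : ∀ {i} → i < suc (climb (parent v)) → Kept (ancestor i v)
    below {zero}  _         = k
    below {suc i} (s≤s i<c) = kept-below-top (parent v) i<c

  climb≤depth : ∀ v → climb v ≤ depth v
  climb≤depth v = proj₂ (proj₂ (climbing v)) (depth v) (root-above-not-kept v)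

  depth-top : ∀ v → depth v ≡ depth (top v) + climb v
  depth-top v = ≡.trans (≡.sym (ℕ.m∸n+n≡m (climb≤depth v))) (cong (_+ climb v) (≡.sym (depth-ancestor (climb v) v)))

  surviving-up : ∀ {x} → Kept x → Surviving x (parent x)
  surviving-up (pos , ¬r) = parent-adjacent pos , ¬r

  surviving-down : ∀ {x p} → Kept x → parent x ≡ p → Surviving p x
  surviving-down (pos , ¬r) refl = ~-sym (parent-adjacent pos) , ¬r ∘ removed-sym

  EarlierSibling : Fin n → Set
  EarlierSibling x = ∃ λ z → Kept z × parent z ≡ parent x × z Fin.< x

  earlier-sibling? : ∀ x → Dec (EarlierSibling x)
  earlier-sibling? x = Fin.any? λ z → kept? z ×-dec (parent z Fin.≟ parent x) ×-dec (z Fin.<? x)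

  side : Fin n → Bool
  side x = does (earlier-sibling? x)

  private
    side-true : ∀ {x} → side x ≡ true → EarlierSibling x
    side-true {x} eq = decidable-stable (earlier-sibling? x) λ ¬e →
      contradiction (≡.trans (≡.sym eq) (dec-false (earlier-sibling? x) ¬e)) λ ()

    -- Equal sides of siblings x < y force an earlier sibling of x: three surviving edges below the parent.
    sides-differ : ∀ {x y} → Kept x → Kept y → parent x ≡ parent y → x Fin.< y → side x ≢ side y
    sides-differ {x} {y} kx ky px≡py x<y sx≡sy
      with side-true (≡.trans sx≡sy (dec-true (earlier-sibling? y) (x , kx , px≡py , x<y)))
    ... | z , kz , pz≡px , z<x = no-surviving-claw acyclic
            (surviving-down kz pz≡px) (surviving-down kx refl) (surviving-down ky (≡.sym px≡py))
            (Fin.<⇒≢ z<x) (Fin.<⇒≢ (Fin.<-trans z<x x<y)) (Fin.<⇒≢ x<y)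

  siblings-by-side : ∀ {x y} → Kept x → Kept y → parent x ≡ parent y → side x ≡ side y → x ≡ y
  siblings-by-side {x} {y} kx ky px≡py sx≡sy with Fin.<-cmp x y
  ... | tri≈ _ x≡y _ = x≡y
  ... | tri< x<y _ _ = contradiction sx≡sy (sides-differ kx ky px≡py x<y)
  ... | tri> _ _ y<x = contradiction (≡.sym sx≡sy) (sides-differ ky kx (≡.sym px≡py) y<x)

  private
    grandparent≢ : ∀ {v} → Kept v → Kept (parent v) → parent (parent v) ≢ v
    grandparent≢ (pv , _) (ppv , _) = ℕ.<⇒≢ (ℕ.<-trans (parent-shallower ppv) (parent-shallower pv)) ∘ cong depth

    kept-at-climb : ∀ {v j} → climb v ≡ suc j → Kept v
    kept-at-climb {v} cv = kept-below-top v (subst (0 <_) (≡.sym cv) (s≤s z≤n))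

  -- Below a kept vertex T − F does not branch.
  descent-unique : ∀ j {v w} → climb v ≡ suc j → climb w ≡ suc j → ancestor j v ≡ ancestor j w → v ≡ w
  descent-unique zero    _ _ same = same
  descent-unique (suc j) {v} {w} cv cw same with v Fin.≟ w
  ... | yes v≡w = v≡w
  ... | no  v≢w = ⊥-elim (no-surviving-claw acyclic (surviving-up kx) (surviving-down kv refl)
                    (surviving-down kw (≡.sym pv≡pw)) (grandparent≢ kv kx)
                    (grandparent≢ kw (subst Kept pv≡pw kx) ∘ ≡.trans (cong parent (≡.sym pv≡pw))) v≢w)
    where
    kv = kept-at-climb cv
    kw = kept-at-climb cw
    cpv = ℕ.suc-injective (≡.trans (≡.sym (climb-kept kv)) cv)
    cpw = ℕ.suc-injective (≡.trans (≡.sym (climb-kept kw)) cw)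
    pv≡pw = descent-unique j cpv cpw same
    kx = kept-at-climb cpv

  parent-below-top : ∀ {v a} → climb v ≡ suc a → parent (ancestor a v) ≡ top v
  parent-below-top {v} {a} cv = ≡.trans (parent-ancestor a v) (cong (λ c → ancestor c v) (≡.sym cv))

  label : Fin n → ℕ
  label v = arm-code (climb v) (side (ancestor (climb v ∸ 1) v))

  label≤ : ∀ v → label v ≤ 2 * climb v
  label≤ v = arm-code≤ (climb v) _

  label-injective : ∀ {v w} → top v ≡ top w → label v ≡ label w → v ≡ w
  label-injective {v} {w} tv≡tw lv≡lw = from (climb v) (climb w) refl refl
    where
    label-at : ∀ x a → climb x ≡ a → label x ≡ arm-code a (side (ancestor (a ∸ 1) x))
    label-at x a = cong λ c → arm-code c (side (ancestor (c ∸ 1) x))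
    codes : ∀ {a b} → climb v ≡ a → climb w ≡ b →
            arm-code a (side (ancestor (a ∸ 1) v)) ≡ arm-code b (side (ancestor (b ∸ 1) w))
    codes {a} {b} cv cw = ≡.trans (≡.sym (label-at v a cv)) (≡.trans lv≡lw (label-at w b cw))
    from : ∀ a b → climb v ≡ a → climb w ≡ b → v ≡ w
    from zero    zero    cv cw = ≡.trans (cong (λ c → ancestor c v) (≡.sym cv)) (≡.trans tv≡tw (cong (λ c → ancestor c w) cw))
    from zero    (suc b) cv cw = contradiction (codes cv cw) λ ()
    from (suc a) zero    cv cw = contradiction (codes cv cw) λ ()
    from (suc a) (suc b) cv cw with arm-code-injective {a} {b} {side (ancestor a v)} {side (ancestor b w)} (codes cv cw)
    ... | refl , same-side = descent-unique a cv cw (siblings-by-side (kept-below-top v (a<c cv)) (kept-below-top w (a<c cw))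
            (≡.trans (parent-below-top cv) (≡.trans tv≡tw (≡.sym (parent-below-top cw)))) same-side)
      where
      a<c : ∀ {x} → climb x ≡ suc a → a < climb x
      a<c cx = subst (a <_) (≡.sym cx) (ℕ.n<1+n a)

  removed-above-top : ∀ v → top v ≢ root → Removed (top v) (parent (top v))
  removed-above-top v t≢root = decidable-stable (removed? _ _) λ ¬r → top-not-kept v (non-root-deep t≢root , ¬r)

  slot : ∀ v → top v ≢ root → Fin (length F)
  slot v t≢root = Any.index (removed-above-top v t≢root)

  slot-injective : ∀ {v w} (p : top v ≢ root) (q : top w ≢ root) → slot v p ≡ slot w q → top v ≡ top w
  slot-injective {v} {w} p q eq = parent-edge-injective {lookup F (slot v p)} (non-root-deep p) (non-root-deep q)
    (Any.lookup-index (removed-above-top v p))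
    (subst (λ i → Joins (lookup F i) (top w) (parent (top w))) (≡.sym eq) (Any.lookup-index (removed-above-top w q)))

  -- Components hanging from removed edges get a slot of M codes each; the component of a may spill
  -- over into O codes of the central component, which that one only needs when a is not a top.
  module Counting (R O M : ℕ) (a : Fin n)
    (central-bound  : ∀ v → top v ≡ root → label v < R + O)
    (central-bound′ : ∀ v → top v ≡ root → ¬ Kept a → a ≢ root → label v < R)
    (a-bound        : ∀ v → top v ≡ a → a ≢ root → label v < M + O)
    (other-bound    : ∀ v → top v ≢ root → top v ≢ a → label v < M) where

    private
      data Class (v : Fin n) : Set where
        central  : top v ≡ root → Class v
        overflow : top v ≢ root → M ≤ label v → Class v
        slotted  : top v ≢ root → label v < M → Class v

      classify : ∀ v → Class v
      classify v = by (top v Fin.≟ root) (M ℕ.≤? label v)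
        where
        by : Dec (top v ≡ root) → Dec (M ≤ label v) → Class v
        by (yes t≡root) _         = central t≡root
        by (no t≢root)  (yes M≤l) = overflow t≢root M≤l
        by (no t≢root)  (no M≰l)  = slotted t≢root (ℕ.≰⇒> M≰l)

      overflow-top : ∀ {v} → top v ≢ root → M ≤ label v → top v ≡ a
      overflow-top {v} t≢root M≤l = decidable-stable (top v Fin.≟ a) λ t≢a → ℕ.<⇒≱ (other-bound v t≢root t≢a) M≤l

      overflow-bound : ∀ {v} → top v ≢ root → M ≤ label v → R + (label v ∸ M) < R + O
      overflow-bound {v} t≢root M≤l = ℕ.+-monoʳ-< R (subst (label v ∸ M <_) (ℕ.m+n∸m≡n M O)
        (ℕ.∸-monoˡ-< (a-bound v t≡a (t≢root ∘ ≡.trans t≡a)) M≤l))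
        where t≡a = overflow-top t≢root M≤l

    count : n ≤ R + O + length F * M
    count = injective⇒≤+* encode (encode-injective (classify _) (classify _))
      where
      encodeᶜ : ∀ v → Class v → Fin (R + O) ⊎ (Fin (length F) × Fin M)
      encodeᶜ v (central t≡root)      = inj₁ (Fin.fromℕ< (central-bound v t≡root))
      encodeᶜ v (overflow t≢root M≤l) = inj₁ (Fin.fromℕ< (overflow-bound t≢root M≤l))
      encodeᶜ v (slotted t≢root l<M)  = inj₂ (slot v t≢root , Fin.fromℕ< l<M)
      encode : Fin n → Fin (R + O) ⊎ (Fin (length F) × Fin M)
      encode v = encodeᶜ v (classify v)
      values : ∀ {x y} .{p : x < R + O} .{q : y < R + O} →
               (Fin (R + O) ⊎ (Fin (length F) × Fin M) ∋ inj₁ (Fin.fromℕ< p)) ≡ inj₁ (Fin.fromℕ< q) → x ≡ y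
      values {p = p} {q} = Fin.fromℕ<-injective _ _ p q ∘ Sum.inj₁-injective
      central-not-overflow : ∀ {v w} → top v ≡ root → top w ≢ root → M ≤ label w → label v ≢ R + (label w ∸ M)
      central-not-overflow {v} {w} tv tw M≤l eq =
        ℕ.m+n≮m R _ (subst (_< R) eq (central-bound′ v tv (subst (λ t → ¬ Kept t) t≡a (top-not-kept w)) (tw ∘ ≡.trans t≡a)))
        where t≡a = overflow-top tw M≤l
      encode-injective : ∀ {v w} (cv : Class v) (cw : Class w) → encodeᶜ v cv ≡ encodeᶜ w cw → v ≡ w
      encode-injective (central tv) (central tw) eq = label-injective (≡.trans tv (≡.sym tw)) (values eq)
      encode-injective (central tv) (overflow tw M≤l) eq = contradiction (values eq) (central-not-overflow tv tw M≤l)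
      encode-injective (overflow tv M≤l) (central tw) eq = contradiction (≡.sym (values eq)) (central-not-overflow tw tv M≤l)
      encode-injective (overflow tv M≤lv) (overflow tw M≤lw) eq = label-injective
        (≡.trans (overflow-top tv M≤lv) (≡.sym (overflow-top tw M≤lw)))
        (ℕ.∸-cancelʳ-≡ M≤lv M≤lw (ℕ.+-cancelˡ-≡ R _ _ (values eq)))
      encode-injective (slotted tv _) (slotted tw _) eq = label-injective
        (slot-injective tv tw (cong proj₁ (Sum.inj₂-injective eq)))
        (Fin.fromℕ<-injective _ _ _ _ (cong proj₂ (Sum.inj₂-injective eq)))

private
  1+2[1+r]≡1+2r+2 : ∀ r → suc (2 * suc r) ≡ suc (2 * r) + 2
  1+2[1+r]≡1+2r+2 = solve-∀

module Diametral {n : ℕ} (G : SimpleGraph n) (tree : IsTree G) {u v : Fin n} {d : ℕ}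
                 (uv : IsDistance (toGraph G) u v d) (diameter : ∀ x y k → IsDistance (toGraph G) x y k → k ≤ d)
                 (r q : ℕ) (r+q≡d : r + q ≡ d) (r≤q : r ≤ q) (1≤r : 1 ≤ r) where
  open Walks G

  private
    halves : ∃[ c ] Walkᴳ u c r × Walkᴳ c v q
    halves = walk-splitAt r (subst (Walkᴳ u v) (≡.sym r+q≡d) (proj₁ uv))

  center : Fin n
  center = proj₁ halves

  open RootedTree G tree center

  private
    geodesic-long : ∀ {k} → Walkᴳ u v k → r + q ≤ k
    geodesic-long {k} p = subst (_≤ k) (≡.sym r+q≡d) (proj₂ uv k p)

    depth-u≤ : depth u ≤ r
    depth-u≤ = depth-minimal u r (proj₁ (proj₂ halves))

    depth-v≤ : depth v ≤ q
    depth-v≤ = depth-minimal v q (walk-reverse (proj₂ (proj₂ halves)))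

    r+q≤ : r + q ≤ depth u + depth v
    r+q≤ = geodesic-long (walk-++ (path-to-root u) (walk-reverse (path-to-root v)))

  depth-u : depth u ≡ r
  depth-u = ℕ.≤-antisym depth-u≤ (ℕ.+-cancelʳ-≤ q r (depth u) (ℕ.≤-trans r+q≤ (ℕ.+-monoʳ-≤ (depth u) depth-v≤)))

  depth-v : depth v ≡ q
  depth-v = ℕ.≤-antisym depth-v≤ (ℕ.+-cancelˡ-≤ r q (depth v) (ℕ.≤-trans r+q≤ (ℕ.+-monoˡ-≤ (depth v) depth-u≤)))

  branches-differ : branch u ≢ branch v
  branches-differ same = ℕ.<⇒≱ short (geodesic-long (walk-++ (ascent (depth u ∸ 1) u (ℕ.m∸n≤m _ 1))
    (subst (λ b → Walkᴳ b v (depth v ∸ 1)) (≡.sym same) (walk-reverse (ascent (depth v ∸ 1) v (ℕ.m∸n≤m _ 1))))))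
    where
    short : (depth u ∸ 1) + (depth v ∸ 1) < r + q
    short = ℕ.+-mono-<-≤
      (subst (λ k → k ∸ 1 < r) (≡.sym depth-u) (subst (r ∸ 1 <_) (ℕ.m∸n+n≡m 1≤r) (ℕ.m<m+n (r ∸ 1) (s≤s z≤n))))
      (ℕ.≤-trans (ℕ.m∸n≤m _ 1) depth-v≤)

  depth-sum-across-branches : ∀ {x y} → branch x ≢ branch y → depth x + depth y ≤ r + q
  depth-sum-across-branches {x} {y} b≢b with distance (proj₁ tree) x y
  ... | k , xy = ℕ.≤-trans (walk-across-branches (proj₁ xy) b≢b) (subst (k ≤_) (≡.sym r+q≡d) (diameter x y k xy))

  depth≤q : ∀ z → depth z ≤ q
  depth≤q z with branch z Fin.≟ branch u
  ... | no  bz≢bu = ℕ.+-cancelʳ-≤ r (depth z) q (subst (λ k → depth z + k ≤ q + r) depth-u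
                      (ℕ.≤-trans (depth-sum-across-branches bz≢bu) (ℕ.≤-reflexive (ℕ.+-comm r q))))
  ... | yes bz≡bu = ℕ.≤-trans (ℕ.+-cancelʳ-≤ q (depth z) r (subst (λ k → depth z + k ≤ r + q) depth-v
                      (depth-sum-across-branches (branches-differ ∘ ≡.trans (≡.sym bz≡bu))))) r≤q

  deepest-in-branch-of-v : r < q → ∀ {z} → depth z ≡ q → branch z ≡ branch v
  deepest-in-branch-of-v r<q {z} dz with branch z Fin.≟ branch v
  ... | yes bz≡bv = bz≡bv
  ... | no  bz≢bv = contradiction (ℕ.+-cancelʳ-≤ q q r (subst (_≤ r + q) (cong₂ _+_ dz depth-v)
                      (depth-sum-across-branches bz≢bv))) (ℕ.<⇒≱ r<q)

  module LowerBound (F : List (Edge G)) (acyclic : AcyclicWithout (LineGraph G) F) where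
    open Components G tree center F acyclic

    climb-central : ∀ {w} → top w ≡ center → climb w ≡ depth w
    climb-central {w} t≡c = ≡.sym (≡.trans (depth-top w) (cong (_+ climb w) (≡.trans (cong depth t≡c) depth-root)))

    depth-top+climb≤q : ∀ w → depth (top w) + climb w ≤ q
    depth-top+climb≤q w = subst (_≤ q) (depth-top w) (depth≤q w)

    climb<q : ∀ {w} → top w ≢ center → climb w < q
    climb<q {w} t≢c = ℕ.≤-trans (ℕ.+-monoˡ-≤ (climb w) (non-root-deep t≢c)) (depth-top+climb≤q w)

    label<1+2* : ∀ {w j} → climb w ≤ j → label w < suc (2 * j)
    label<1+2* {w} c≤j = s≤s (ℕ.≤-trans (label≤ w) (ℕ.*-monoʳ-≤ 2 c≤j))

    label<2*∸1 : ∀ {w j} → climb w < j → label w < 2 * j ∸ 1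
    label<2*∸1 {w} {j} c<j = ℕ.m+n≤o⇒m≤o∸n (suc (label w)) (begin
      suc (label w) + 1      ≡⟨ ℕ.+-comm (suc (label w)) 1 ⟩
      2 + label w            ≤⟨ ℕ.+-monoʳ-≤ 2 (label≤ w) ⟩
      2 + 2 * climb w        ≡⟨ ℕ.*-suc 2 (climb w) ⟨
      2 * suc (climb w)      ≤⟨ ℕ.*-monoʳ-≤ 2 c<j ⟩
      2 * j                  ∎)
      where open ℕ.≤-Reasoning

    module Even (q≡r : q ≡ r) where

      count : n ≤ 2 * r + 1 + length F * (2 * r ∸ 1)
      count = Counting.count (2 * r) 1 (2 * r ∸ 1) center central-bound (λ _ _ _ c≢c → contradiction refl c≢c)
                (λ _ _ c≢c → contradiction refl c≢c) other-bound
        where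
        central-bound : ∀ w → top w ≡ center → label w < 2 * r + 1
        central-bound w t≡c = subst (label w <_) (ℕ.+-comm 1 (2 * r))
          (label<1+2* (subst (_≤ r) (≡.sym (climb-central t≡c)) (subst (depth w ≤_) q≡r (depth≤q w))))
        other-bound : ∀ w → top w ≢ center → top w ≢ center → label w < 2 * r ∸ 1
        other-bound w t≢c _ = label<2*∸1 (subst (climb w <_) q≡r (climb<q t≢c))

    module Odd (q≡1+r : q ≡ suc r) where

      a : Fin n
      a = branch v

      depth≤1+r : ∀ w → depth w ≤ suc r
      depth≤1+r w = subst (depth w ≤_) q≡1+r (depth≤q w)

      deepest-below-a : ∀ {w} → depth w ≡ suc r → branch w ≡ a
      deepest-below-a dw = deepest-in-branch-of-v (subst (r <_) (≡.sym q≡1+r) (ℕ.n<1+n r)) (≡.trans dw (≡.sym q≡1+r))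

      central-bound : ∀ w → top w ≡ center → label w < suc (2 * r) + 2
      central-bound w t≡c = subst (label w <_) (1+2[1+r]≡1+2r+2 r)
        (label<1+2* (subst (_≤ suc r) (≡.sym (climb-central t≡c)) (depth≤1+r w)))

      -- The vertices of depth q lie below a, so they leave the centre's component once a is not kept.
      central-bound′ : ∀ w → top w ≡ center → ¬ Kept a → a ≢ center → label w < suc (2 * r)
      central-bound′ w t≡c ¬ka _ = label<1+2* (subst (_≤ r) (≡.sym (climb-central t≡c)) (ℕ.≤-pred shallow))
        where
        shallow : depth w < suc r
        shallow = ℕ.≤∧≢⇒< (depth≤1+r w) λ dw≡1+r → ¬ka (subst Kept
          (≡.trans (cong (λ k → ancestor (k ∸ 1) w) (climb-central t≡c)) (deepest-below-a dw≡1+r))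
          (kept-below-top w (subst (λ k → k ∸ 1 < k) (≡.sym (≡.trans (climb-central t≡c) dw≡1+r)) (ℕ.n<1+n r))))

      depth-a : depth a ≡ 1
      depth-a = ≡.trans (depth-ancestor (depth v ∸ 1) v)
        (ℕ.m∸[m∸n]≡n (subst (1 ≤_) (≡.sym (≡.trans depth-v q≡1+r)) (s≤s z≤n)))

      a-bound : ∀ w → top w ≡ a → a ≢ center → label w < (2 * r ∸ 1) + 2
      a-bound w t≡a _ = subst (label w <_) 1+2r≡2r∸1+2 (label<1+2* (ℕ.≤-pred (begin
        suc (climb w)                ≡⟨ cong (_+ climb w) (≡.sym (≡.trans (cong depth t≡a) depth-a)) ⟩
        depth (top w) + climb w      ≤⟨ depth-top+climb≤q w ⟩
        q                            ≡⟨ q≡1+r ⟩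
        suc r                        ∎)))
        where
        open ℕ.≤-Reasoning
        1+2r≡2r∸1+2 : suc (2 * r) ≡ (2 * r ∸ 1) + 2
        1+2r≡2r∸1+2 = ≡.sym (≡.trans (ℕ.+-suc (2 * r ∸ 1) 1) (cong suc (ℕ.m∸n+n≡m (ℕ.≤-trans 1≤r (ℕ.m≤n*m r 2)))))

      -- A component of climb r hanging at depth 1 reaches depth q, so it is the one of a.
      climb<r : ∀ {w} → top w ≢ center → top w ≢ a → climb w < r
      climb<r {w} t≢c t≢a with climb w ℕ.<? r
      ... | yes c<r = c<r
      ... | no  c≮r = contradiction top≡a t≢a
        where
        r≤c = ℕ.≮⇒≥ c≮r
        dt≥1 = non-root-deep t≢c
        sum≤ : depth (top w) + climb w ≤ suc r
        sum≤ = subst (depth (top w) + climb w ≤_) q≡1+r (depth-top+climb≤q w)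
        c≡r : climb w ≡ r
        c≡r = ℕ.≤-antisym (ℕ.≤-pred (ℕ.≤-trans (ℕ.+-monoˡ-≤ (climb w) dt≥1) sum≤)) r≤c
        dw≡1+r : depth w ≡ suc r
        dw≡1+r = ℕ.≤-antisym (depth≤1+r w) (subst (suc r ≤_) (≡.sym (depth-top w)) (ℕ.+-mono-≤ dt≥1 r≤c))
        top≡a : top w ≡ a
        top≡a = ≡.trans (cong (λ k → ancestor k w) (≡.trans c≡r (≡.sym (cong (_∸ 1) dw≡1+r)))) (deepest-below-a dw≡1+r)

      count : n ≤ suc (2 * r) + 2 + length F * (2 * r ∸ 1)
      count = Counting.count (suc (2 * r)) 2 (2 * r ∸ 1) a central-bound central-bound′ a-bound
                λ w t≢c t≢a → label<2*∸1 (climb<r t≢c t≢a)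

⌈/⌉≤ : ∀ {x m K} → x ≤ K * m → ⌈ x / m ⌉ ≤ K
⌈/⌉≤ {m = zero}          _  = z≤n
⌈/⌉≤ {x} {suc c} {K} x≤ = ℕ.≤-pred (m<n*o⇒m/o<n (s≤s (begin
  x + c         ≤⟨ ℕ.+-monoˡ-≤ c x≤ ⟩
  K * suc c + c ≡⟨ ℕ.+-comm (K * suc c) c ⟩
  c + K * suc c ∎)))
  where open ℕ.≤-Reasoning

ceil-bound : ∀ {n K m} a b → n ≤ a + b + K * m → ⌈ n ∸ a ∸ b / m ⌉ ≤ K
ceil-bound {n} {K} {m} a b n≤ = ⌈/⌉≤ (subst (_≤ K * m) (≡.sym (ℕ.∸-+-assoc n a b)) (ℕ.m≤n+o⇒m∸n≤o n (a + b) n≤))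

private
  double : ∀ r → r + r ≡ 2 * r
  double = solve-∀

  double+1 : ∀ r → r + suc r ≡ suc (2 * r)
  double+1 = solve-∀

  halves : ∀ d → d ≡ d % 2 + 2 * (d / 2)
  halves d = ≡.trans (m≡m%n+[m/n]*n d 2) (cong (d % 2 +_) (ℕ.*-comm (d / 2) 2))

module _ {n : ℕ} (G : SimpleGraph n) (tree : IsTree G) {d : ℕ} (diam : IsDiameter (toGraph G) d) (4≤d : 4 ≤ d)
         (F : List (Edge G)) (acyclic : AcyclicWithout (LineGraph G) F) where

  private
    uv = proj₂ (proj₂ (proj₁ diam))
    1≤r : 1 ≤ d / 2
    1≤r = m≥n⇒m/n>0 (ℕ.≤-trans (s≤s (s≤s z≤n)) 4≤d)

  lower-bound-even : d % 2 ≡ 0 → ⌈ n ∸ d ∸ 1 / d ∸ 1 ⌉ ≤ length F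
  lower-bound-even even = ceil-bound d 1 (subst (λ e → n ≤ e + 1 + length F * (e ∸ 1)) (≡.sym d≡2r) (Even.count refl))
    where
    r = d / 2
    d≡2r : d ≡ 2 * r
    d≡2r = ≡.trans (halves d) (cong (_+ 2 * r) even)
    open Diametral G tree uv (proj₂ diam) r r (≡.trans (double r) (≡.sym d≡2r)) ℕ.≤-refl 1≤r
    open LowerBound F acyclic

  lower-bound-odd : d % 2 ≡ 1 → ⌈ n ∸ d ∸ 2 / d ∸ 2 ⌉ ≤ length F
  lower-bound-odd odd = ceil-bound d 2 (subst (λ e → n ≤ e + 2 + length F * (e ∸ 2)) (≡.sym d≡1+2r) (Odd.count refl))
    where
    r = d / 2
    d≡1+2r : d ≡ suc (2 * r)
    d≡1+2r = ≡.trans (halves d) (cong (_+ 2 * r) odd)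
    open Diametral G tree uv (proj₂ diam) r (suc r) (≡.trans (double+1 r) (≡.sym d≡1+2r)) (ℕ.n≤1+n r) 1≤r
    open LowerBound F acyclic

mainTheorem1 : (n : ℕ) (T : SimpleGraph n) (d : ℕ) → IsTree T →
    IsDiameter (toGraph T) d → 4 ≤ d →
    (k : ℕ) → IsDecyclingNumber (LineGraph T) k →
    (d % 2 ≡ 0 → ⌈ n ∸ d ∸ 1 / d ∸ 1 ⌉ ≤ k × k ≤ n ∸ d ∸ 1) ×
    (d % 2 ≡ 1 → ⌈ n ∸ d ∸ 2 / d ∸ 2 ⌉ ≤ k × k ≤ n ∸ d ∸ 1)
mainTheorem1 n T d tree diam 4≤d k ∇≡k@((F , (_ , acyclic) , |F|≡k) , _) =
  (λ even → at-most-k (lower-bound-even T tree diam 4≤d F acyclic even) , upper) ,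
  (λ odd  → at-most-k (lower-bound-odd  T tree diam 4≤d F acyclic odd)  , upper)
  where
  at-most-k : ∀ {x} → x ≤ length F → x ≤ k
  at-most-k = subst (_ ≤_) |F|≡k
  upper : k ≤ n ∸ d ∸ 1
  upper = UpperBound.upper-bound T tree (proj₂ (proj₂ (proj₁ diam))) ∇≡k
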